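{- Let $k\geq 2$, $1\le x\le 2k-1$, $n=2k+x$, and let $p$ be a positive integer with $p\leq \lambda^k(C_n)$. Then there exist positive integers $n_1,\dots,n_p$ with $n_1+\dots+n_p=n$ such that $$\sum_{i=1}^{p}\left\lfloor \frac{n_i(n_i-1)}{2k}\right\rfloor+\sum_{i=1}^{p}\sum_{j=i+1}^{p}\left\lfloor \frac{n_in_j}{k}\right\rfloor\geq n.$$
   Context: $C_n$ is the cycle on $n$ vertices and $K_n$ the complete graph on $n$ vertices. A $p$-labeled packing of $k$ copies of $C_n$ into $K_n$ is a map $f$ from $V(K_n)$ onto a set of exactly $p$ labels together with injections $\sigma_1,\dots,\sigma_k:V(C_n)\to V(K_n)$ such that for $i\neq j$ the induced edge images $\sigma_i^*(E(C_n))$ and $\sigma_j^*(E(C_n))$ are disjoint, and for every $v\in V(C_n)$, $f(\sigma_1(v))=\dots=f(\sigma_k(v))$. $\lambda^k(C_n)$ is the largest $p$ for which such a packing exists. -}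

module Defs where

open import Data.Nat using (ℕ; zero; suc; _+_; _*_; _/_; _≤_)
open import Data.Fin using (Fin; toℕ)
open import Data.Product using (Σ; _×_; _,_; ∃)
open import Data.Sum using (_⊎_)
open import Function.Definitions using (Injective; Surjective)
open import Relation.Binary.PropositionalEquality using (_≡_)
open import Relation.Nullary using (¬_)

-- The cycle C_n on vertex set Fin n (vertices 0,1,…,n-1 in cyclic order).
-- Every edge of C_n is {u , v} for some u, v with Next n u v.
Next : (n : ℕ) → Fin n → Fin n → Set
Next n u v = (suc (toℕ u) ≡ toℕ v) ⊎ ((suc (toℕ u) ≡ n) × (toℕ v ≡ 0))

SamePair : ∀ {A : Set} → A → A → A → A → Set
SamePair a b c d = ((a ≡ c) × (b ≡ d)) ⊎ ((a ≡ d) × (b ≡ c))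

-- A p-labeled packing of k copies of C_n into K_n (both on vertex set Fin n):
-- a labeling f : V(K_n) → Fin p that is onto (exactly p labels), injections
-- σ_1..σ_k : V(C_n) → V(K_n) with pairwise edge-disjoint edge images, and
-- f (σ_i v) independent of i for every v.
record LabeledPacking (n k p : ℕ) : Set where
  field
    f      : Fin n → Fin p
    f-onto : Surjective _≡_ _≡_ f
    σ      : Fin k → Fin n → Fin n
    σ-inj  : ∀ i → Injective _≡_ _≡_ (σ i)
    disjoint : ∀ i j → ¬ (i ≡ j) → ∀ u v a b → Next n u v → Next n a b →
               ¬ SamePair (σ i u) (σ i v) (σ j a) (σ j b)
    label-agree : ∀ i j v → f (σ i v) ≡ f (σ j v)

-- p ≤ λ^k(C_n), where λ^k(C_n) is the largest p' admitting a p'-labeled packing: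
-- equivalently, some p' ≥ p admits a p'-labeled packing.
LeLambda : (p k n : ℕ) → Set
LeLambda p k n = Σ ℕ λ p' → (p ≤ p') × LabeledPacking n k p'

sumFin : (p : ℕ) → (Fin p → ℕ) → ℕ
sumFin zero g = 0
sumFin (suc p) g = g Data.Fin.zero + sumFin p (λ i → g (Data.Fin.suc i))

sumPairs : (p : ℕ) → (Fin p → Fin p → ℕ) → ℕ
sumPairs zero h = 0
sumPairs (suc p) h =
  sumFin p (λ j → h Data.Fin.zero (Data.Fin.suc j))
  + sumPairs p (λ i j → h (Data.Fin.suc i) (Data.Fin.suc j))

floorDiv : ℕ → ℕ → ℕ
floorDiv a zero = 0
floorDiv a (suc b) = a / suc b

-- Let m c be the number of vertices of K_n with label c, and N c d the number of cycle
-- edges t → t+1 whose ends carry labels c and d.  Each such edge has k edge-disjoint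
-- images, all joining a vertex labelled c to one labelled d, so, counting ordered pairs,
-- k (N c d + N d c) ≤ m c m d and 2 k N c c ≤ m c (m c - 1).  Since the N c d add up to
-- the n edges of C_n, taking floors and summing gives the inequality.  A packing with
-- more than p labels is first coarsened to exactly p labels by merging classes.
module Submission where

open import Defs
open import Data.Nat using (ℕ; zero; suc; _+_; _*_; _∸_; _/_; _⊓_; _≤_; _≥_; z≤n; s≤s)
open import Data.Nat.Properties hiding (_≟_)
open import Data.Nat.DivMod using (m*n/n≡m; /-monoˡ-≤)
open import Data.Nat.Solver using (module +-*-Solver)
open import Data.Bool using (true; false; if_then_else_)
open import Data.Fin using (Fin; toℕ; fromℕ<; inject≤)
import Data.Fin as Fin
open import Data.Fin.Properties using (_≟_; toℕ-injective; toℕ-fromℕ<; toℕ-inject≤; toℕ<n)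
open import Data.Product using (Σ; _×_; _,_; proj₁; proj₂)
open import Data.Sum using (inj₁; inj₂; [_,_]′)
open import Data.List using (List; []; _∷_; length; filter; map; _++_; allFin; cartesianProductWith; cartesianProduct)
open import Data.List.Properties using (length-map; length-++; length-tabulate; length-removeAt′; filter-all; filter-some)
open import Data.List.Relation.Unary.Any using (here; there; _─_)
import Data.List.Relation.Unary.Any as Any
import Data.List.Relation.Unary.All as All
open import Data.List.Relation.Unary.All.Properties using (all-filter)
open import Data.List.Relation.Unary.AllPairs using (_∷_)
open import Data.List.Relation.Unary.Unique.Propositional using (Unique)
import Data.List.Relation.Unary.Unique.Propositional.Properties as Unique
open import Data.List.Relation.Binary.Subset.Propositional using (_⊆_)
open import Data.List.Relation.Binary.Disjoint.Propositional using (Disjoint)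
open import Data.List.Membership.Propositional using (_∈_)
open import Data.List.Membership.Propositional.Properties
  using (∈-++⁻; ∈-map⁻; ∈-allFin; ∈-filter⁺; ∈-filter⁻; ∈-cartesianProduct⁺; ∈-cartesianProductWith⁻)
open import Function using (_∘_)
open import Function.Definitions using (Surjective)
import Function.Construct.Composition as Compose
open import Relation.Binary.PropositionalEquality
open import Relation.Nullary using (¬_; yes; no; does; contradiction)

sumFin-cong : ∀ p {g h : Fin p → ℕ} → (∀ i → g i ≡ h i) → sumFin p g ≡ sumFin p h
sumFin-cong zero    g≡h = refl
sumFin-cong (suc p) g≡h = cong₂ _+_ (g≡h Fin.zero) (sumFin-cong p (g≡h ∘ Fin.suc))

sumFin-mono-≤ : ∀ p {g h : Fin p → ℕ} → (∀ i → g i ≤ h i) → sumFin p g ≤ sumFin p h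
sumFin-mono-≤ zero    g≤h = z≤n
sumFin-mono-≤ (suc p) g≤h = +-mono-≤ (g≤h Fin.zero) (sumFin-mono-≤ p (g≤h ∘ Fin.suc))

sumPairs-mono-≤ : ∀ p {g h : Fin p → Fin p → ℕ} → (∀ i j → g i j ≤ h i j) →
                  sumPairs p g ≤ sumPairs p h
sumPairs-mono-≤ zero    g≤h = z≤n
sumPairs-mono-≤ (suc p) g≤h =
  +-mono-≤ (sumFin-mono-≤ p (g≤h Fin.zero ∘ Fin.suc))
           (sumPairs-mono-≤ p (λ i j → g≤h (Fin.suc i) (Fin.suc j)))

sumFin-zero : ∀ p → sumFin p (λ _ → 0) ≡ 0
sumFin-zero zero    = refl
sumFin-zero (suc p) = sumFin-zero p

sumFin-+ : ∀ p (g h : Fin p → ℕ) → sumFin p (λ i → g i + h i) ≡ sumFin p g + sumFin p h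
sumFin-+ zero    g h = refl
sumFin-+ (suc p) g h = begin
  (g₀ + h₀) + sumFin p (λ i → g (Fin.suc i) + h (Fin.suc i))
    ≡⟨ cong ((g₀ + h₀) +_) (sumFin-+ p (g ∘ Fin.suc) (h ∘ Fin.suc)) ⟩
  (g₀ + h₀) + (sumFin p (g ∘ Fin.suc) + sumFin p (h ∘ Fin.suc))
    ≡⟨ +-*-Solver.solve 4 (λ a b c d → (a :+ b) :+ (c :+ d) := (a :+ c) :+ (b :+ d))
                          refl g₀ h₀ _ _ ⟩
  (g₀ + sumFin p (g ∘ Fin.suc)) + (h₀ + sumFin p (h ∘ Fin.suc)) ∎
  where
  open ≡-Reasoning
  open +-*-Solver
  g₀ = g Fin.zero
  h₀ = h Fin.zero

sumFin-indicator : ∀ {p} (a : Fin p) → sumFin p (λ c → if does (a ≟ c) then 1 else 0) ≡ 1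
sumFin-indicator {suc p} Fin.zero    = cong suc (sumFin-zero p)
sumFin-indicator {suc p} (Fin.suc a) = sumFin-indicator a

sumFin²≡diagonal+sumPairs : ∀ p (H : Fin p → Fin p → ℕ) →
  sumFin p (λ c → sumFin p (H c)) ≡ sumFin p (λ c → H c c) + sumPairs p (λ c d → H c d + H d c)
sumFin²≡diagonal+sumPairs zero    H = refl
sumFin²≡diagonal+sumPairs (suc p) H = begin
  (H₀₀ + row) + sumFin p (λ i → H (Fin.suc i) Fin.zero + sumFin p (H (Fin.suc i) ∘ Fin.suc))
    ≡⟨ cong ((H₀₀ + row) +_) (sumFin-+ p _ _) ⟩
  (H₀₀ + row) + (column + sumFin p (λ i → sumFin p (H (Fin.suc i) ∘ Fin.suc)))
    ≡⟨ cong (λ z → (H₀₀ + row) + (column + z)) (sumFin²≡diagonal+sumPairs p H′) ⟩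
  (H₀₀ + row) + (column + (diagonal + pairs))
    ≡⟨ +-*-Solver.solve 5 (λ a b c d e → (a :+ b) :+ (c :+ (d :+ e)) := (a :+ d) :+ ((b :+ c) :+ e))
                          refl H₀₀ row column diagonal pairs ⟩
  (H₀₀ + diagonal) + ((row + column) + pairs)
    ≡⟨ cong (λ z → (H₀₀ + diagonal) + (z + pairs)) (sym (sumFin-+ p _ _)) ⟩
  (H₀₀ + diagonal) + (sumFin p (λ j → H Fin.zero (Fin.suc j) + H (Fin.suc j) Fin.zero) + pairs) ∎
  where
  open ≡-Reasoning
  open +-*-Solver
  H′ : Fin p → Fin p → ℕ
  H′ i j = H (Fin.suc i) (Fin.suc j)
  H₀₀ = H Fin.zero Fin.zero
  row = sumFin p (H Fin.zero ∘ Fin.suc)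
  column = sumFin p (λ i → H (Fin.suc i) Fin.zero)
  diagonal = sumFin p (λ c → H′ c c)
  pairs = sumPairs p (λ c d → H′ c d + H′ d c)

module _ {A : Set} where

  ∈-─ : ∀ {x y : A} {xs} (x∈xs : x ∈ xs) → y ∈ xs → x ≢ y → y ∈ (xs ─ x∈xs)
  ∈-─ (here refl) (here refl)  x≢y = contradiction refl x≢y
  ∈-─ (here _)    (there y∈xs) _   = y∈xs
  ∈-─ (there _)   (here y≡z)   _   = here y≡z
  ∈-─ (there x∈xs) (there y∈xs) x≢y = there (∈-─ x∈xs y∈xs x≢y)

  Unique-⊆⇒length-≤ : ∀ {xs ys : List A} → Unique xs → xs ⊆ ys → length xs ≤ length ys
  Unique-⊆⇒length-≤ {[]}     _               _     = z≤n
  Unique-⊆⇒length-≤ {x ∷ xs} {ys} (x∉xs ∷ xs!) xs⊆ys =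
    subst (suc (length xs) ≤_) (sym (length-removeAt′ ys (Any.index x∈ys)))
      (s≤s (Unique-⊆⇒length-≤ xs! λ y∈xs →
        ∈-─ x∈ys (xs⊆ys (there y∈xs)) (All.lookup x∉xs y∈xs)))
    where x∈ys = xs⊆ys (here refl)

  ++-⊆ : ∀ {xs ys zs : List A} → xs ⊆ zs → ys ⊆ zs → xs ++ ys ⊆ zs
  ++-⊆ {xs} xs⊆zs ys⊆zs v∈ = [ xs⊆zs , ys⊆zs ]′ (∈-++⁻ xs v∈)

  Disjoint-++ʳ : ∀ {xs ys zs : List A} → Disjoint xs ys → Disjoint xs zs → Disjoint xs (ys ++ zs)
  Disjoint-++ʳ {ys = ys} xs#ys xs#zs (v∈xs , v∈ys++zs) =
    [ (λ v∈ys → xs#ys (v∈xs , v∈ys)) , (λ v∈zs → xs#zs (v∈xs , v∈zs)) ]′ (∈-++⁻ ys v∈ys++zs)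

length-cartesianProductWith : ∀ {A B C : Set} (f : A → B → C) xs ys →
  length (cartesianProductWith f xs ys) ≡ length xs * length ys
length-cartesianProductWith f []       ys = refl
length-cartesianProductWith f (x ∷ xs) ys = begin
  length (map (f x) ys ++ cartesianProductWith f xs ys)
    ≡⟨ length-++ (map (f x) ys) ⟩
  length (map (f x) ys) + length (cartesianProductWith f xs ys)
    ≡⟨ cong₂ _+_ (length-map (f x) ys) (length-cartesianProductWith f xs ys) ⟩
  length ys + length xs * length ys ∎
  where open ≡-Reasoning

length-allFin : ∀ n → length (allFin n) ≡ n
length-allFin n = length-tabulate (λ i → i)

module _ {A : Set} {p : ℕ} where

  fibre : (A → Fin p) → Fin p → List A → List A
  fibre h c = filter (λ x → h x ≟ c)

  ∈-fibre⁺ : ∀ (h : A → Fin p) {c} xs {x} → x ∈ xs → h x ≡ c → x ∈ fibre h c xs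
  ∈-fibre⁺ h {c} _ = ∈-filter⁺ (λ x → h x ≟ c)

  ∈-fibre⁻ : ∀ (h : A → Fin p) {c} xs {x} → x ∈ fibre h c xs → x ∈ xs × h x ≡ c
  ∈-fibre⁻ h {c} _ = ∈-filter⁻ (λ x → h x ≟ c)

  length-fibre-∷ : ∀ (h : A → Fin p) c y ys →
    length (fibre h c (y ∷ ys)) ≡ (if does (h y ≟ c) then 1 else 0) + length (fibre h c ys)
  length-fibre-∷ h c y ys with does (h y ≟ c)
  ... | true  = refl
  ... | false = refl

  sumFin-length-fibre : ∀ (h : A → Fin p) xs → sumFin p (λ c → length (fibre h c xs)) ≡ length xs
  sumFin-length-fibre h []       = sumFin-zero p
  sumFin-length-fibre h (y ∷ ys) = begin
    sumFin p (λ c → length (fibre h c (y ∷ ys)))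
      ≡⟨ sumFin-cong p (λ c → length-fibre-∷ h c y ys) ⟩
    sumFin p (λ c → (if does (h y ≟ c) then 1 else 0) + length (fibre h c ys))
      ≡⟨ sumFin-+ p _ _ ⟩
    sumFin p (λ c → if does (h y ≟ c) then 1 else 0) + sumFin p (λ c → length (fibre h c ys))
      ≡⟨ cong₂ _+_ (sumFin-indicator (h y)) (sumFin-length-fibre h ys) ⟩
    suc (length ys) ∎
    where open ≡-Reasoning

≤-floorDiv : ∀ a b d → suc d * a ≤ b → a ≤ floorDiv b (suc d)
≤-floorDiv a b d da≤b = begin
  a                 ≡⟨ sym (m*n/n≡m a (suc d)) ⟩
  a * suc d / suc d ≡⟨ cong (_/ suc d) (*-comm a (suc d)) ⟩
  suc d * a / suc d ≤⟨ /-monoˡ-≤ (suc d) da≤b ⟩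
  b / suc d         ∎
  where open ≤-Reasoning

next : ∀ {n} → Fin n → Fin n
next {suc m} t with suc (toℕ t) <? suc m
... | yes t+1<n = fromℕ< t+1<n
... | no  _     = Fin.zero

next-Next : ∀ {n} (t : Fin n) → Next n t (next t)
next-Next {suc m} t with suc (toℕ t) <? suc m
... | yes t+1<n = inj₁ (sym (toℕ-fromℕ< t+1<n))
... | no  t+1≮n = inj₂ (≤-antisym (toℕ<n t) (≮⇒≥ t+1≮n) , refl)

Next-irreflexive : ∀ {n} {t : Fin n} → 2 ≤ n → ¬ Next n t t
Next-irreflexive _   (inj₁ t+1≡t)          = <-irrefl refl (≤-reflexive t+1≡t)
Next-irreflexive 2≤n (inj₂ (t+1≡n , t≡0)) =
  <-irrefl refl (subst (2 ≤_) (trans (sym t+1≡n) (cong suc t≡0)) 2≤n)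

-- Apart from t < u < t, every case forces n ≤ 2.
Next-asymmetric : ∀ {n} {t u : Fin n} → 3 ≤ n → Next n t u → ¬ Next n u t
Next-asymmetric _ (inj₁ t+1≡u) (inj₁ u+1≡t) = <-asym (≤-reflexive t+1≡u) (≤-reflexive u+1≡t)
Next-asymmetric 3≤n (inj₁ t+1≡u) (inj₂ (u+1≡n , t≡0)) =
  <-irrefl refl (subst (3 ≤_) (trans (sym u+1≡n) (cong suc (trans (sym t+1≡u) (cong suc t≡0)))) 3≤n)
Next-asymmetric 3≤n (inj₂ (t+1≡n , u≡0)) (inj₁ u+1≡t) =
  <-irrefl refl (subst (3 ≤_) (trans (sym t+1≡n) (cong suc (trans (sym u+1≡t) (cong suc u≡0)))) 3≤n)
Next-asymmetric 3≤n (inj₂ (t+1≡n , _)) (inj₂ (_ , t≡0)) =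
  <-irrefl refl (subst (2 ≤_) (trans (sym t+1≡n) (cong suc t≡0)) (<⇒≤ 3≤n))

relabel : ∀ {n k p p′} (r : Fin p′ → Fin p) → Surjective _≡_ _≡_ r →
          LabeledPacking n k p′ → LabeledPacking n k p
relabel r r-onto P = record
  { f           = r ∘ f
  ; f-onto      = Compose.surjective _≡_ _≡_ _≡_ f-onto r-onto
  ; σ           = σ
  ; σ-inj       = σ-inj
  ; disjoint    = disjoint
  ; label-agree = λ i j v → cong r (label-agree i j v)
  }
  where open LabeledPacking P

clamp : ∀ {p′} q → Fin p′ → Fin (suc q)
clamp q c = fromℕ< (s≤s (m⊓n≤n (toℕ c) q))

clamp-surjective : ∀ {p′} q → suc q ≤ p′ → Surjective _≡_ _≡_ (clamp {p′} q)
clamp-surjective q q<p′ y = inject≤ y q<p′ , λ {c} c≡y → toℕ-injective (begin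
  toℕ (clamp q c)          ≡⟨ toℕ-fromℕ< _ ⟩
  toℕ c ⊓ q                ≡⟨ cong (λ d → toℕ d ⊓ q) c≡y ⟩
  toℕ (inject≤ y q<p′) ⊓ q ≡⟨ cong (_⊓ q) (toℕ-inject≤ y q<p′) ⟩
  toℕ y ⊓ q                ≡⟨ m≤n⇒m⊓n≡m (≤-pred (toℕ<n y)) ⟩
  toℕ y                    ∎)
  where open ≡-Reasoning

LeLambda⇒LabeledPacking : ∀ {p k n} → 1 ≤ p → LeLambda p k n → LabeledPacking n k p
LeLambda⇒LabeledPacking {suc q} _ (p′ , p≤p′ , P) = relabel (clamp q) (clamp-surjective q p≤p′) P

module ClassCounting {n k p} (3≤n : 3 ≤ n) (P : LabeledPacking n (suc k) p) where
  open LabeledPacking P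

  label : Fin n → Fin p
  label = f ∘ σ Fin.zero

  class : Fin p → List (Fin n)
  class c = fibre f c (allFin n)

  size : Fin p → ℕ
  size c = length (class c)

  edges : Fin p → Fin p → List (Fin n)
  edges c d = fibre (label ∘ next) d (fibre label c (allFin n))

  count : Fin p → Fin p → ℕ
  count c d = length (edges c d)

  arc arcʳ : Fin (suc k) → Fin n → Fin n × Fin n
  arc  i t = σ i t , σ i (next t)
  arcʳ i t = σ i (next t) , σ i t

  -- For c = d the loops fill the diagonal of class c × class c; this is where m² becomes m (m - 1).
  arcs arcsʳ loops : Fin p → Fin p → List (Fin n × Fin n)
  arcs  c d = cartesianProductWith arc  (allFin (suc k)) (edges c d)
  arcsʳ c d = cartesianProductWith arcʳ (allFin (suc k)) (edges d c)
  loops c d = map (λ w → w , w) (fibre f d (class c))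

  arc-collision : ∀ {i j t s} → SamePair (σ i t) (σ i (next t)) (σ j s) (σ j (next s)) →
                  i ≡ j × t ≡ s
  arc-collision {i} {j} {t} {s} same with i ≟ j
  ... | no i≢j = contradiction same
        (disjoint i j i≢j t (next t) s (next s) (next-Next t) (next-Next s))
  ... | yes refl with same
  ...   | inj₁ (σt≡σs , _)      = refl , σ-inj i σt≡σs
  ...   | inj₂ (σt≡σs⁺ , σt⁺≡σs) = contradiction
        (subst (Next n t) (σ-inj i σt⁺≡σs) (next-Next t))
        (Next-asymmetric 3≤n (subst (Next n s) (sym (σ-inj i σt≡σs⁺)) (next-Next s)))

  arc-not-loop : ∀ i t → σ i t ≢ σ i (next t)
  arc-not-loop i t σt≡σt⁺ =
    Next-irreflexive (<⇒≤ 3≤n) (subst (Next n t) (sym (σ-inj i σt≡σt⁺)) (next-Next t))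

  arc-injective : ∀ {i j t s} → arc i t ≡ arc j s → i ≡ j × t ≡ s
  arc-injective e = arc-collision (inj₁ (cong proj₁ e , cong proj₂ e))

  arcʳ-injective : ∀ {i j t s} → arcʳ i t ≡ arcʳ j s → i ≡ j × t ≡ s
  arcʳ-injective e = arc-collision (inj₁ (cong proj₂ e , cong proj₁ e))

  arc≢arcʳ : ∀ i j t s → arc i t ≢ arcʳ j s
  arc≢arcʳ i j t s e with arc-collision (inj₂ (cong proj₁ e , cong proj₂ e))
  ... | refl , refl = arc-not-loop i t (cong proj₁ e)

  ∈-class : ∀ {w c} → f w ≡ c → w ∈ class c
  ∈-class = ∈-fibre⁺ f (allFin n) (∈-allFin _)

  σ-∈-class : ∀ i {t c} → label t ≡ c → σ i t ∈ class c
  σ-∈-class i ℓt≡c = ∈-class (trans (label-agree i Fin.zero _) ℓt≡c)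

  ∈-edges⁻ : ∀ {t c d} → t ∈ edges c d → label t ≡ c × label (next t) ≡ d
  ∈-edges⁻ {c = c} t∈ with ∈-fibre⁻ (label ∘ next) (fibre label c (allFin n)) t∈
  ... | t∈₁ , ℓt⁺≡d = proj₂ (∈-fibre⁻ label (allFin n) t∈₁) , ℓt⁺≡d

  classPairs : Fin p → Fin p → List (Fin n × Fin n)
  classPairs c d = cartesianProduct (class c) (class d)

  arcs⊆classPairs : ∀ c d → arcs c d ⊆ classPairs c d
  arcs⊆classPairs c d v∈ with ∈-cartesianProductWith⁻ arc (allFin _) (edges c d) v∈
  ... | i , t , _ , t∈ , refl =
    ∈-cartesianProduct⁺ (σ-∈-class i (proj₁ (∈-edges⁻ t∈))) (σ-∈-class i (proj₂ (∈-edges⁻ t∈)))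

  arcsʳ⊆classPairs : ∀ c d → arcsʳ c d ⊆ classPairs c d
  arcsʳ⊆classPairs c d v∈ with ∈-cartesianProductWith⁻ arcʳ (allFin _) (edges d c) v∈
  ... | i , t , _ , t∈ , refl =
    ∈-cartesianProduct⁺ (σ-∈-class i (proj₂ (∈-edges⁻ t∈))) (σ-∈-class i (proj₁ (∈-edges⁻ t∈)))

  loops⊆classPairs : ∀ c d → loops c d ⊆ classPairs c d
  loops⊆classPairs c d v∈ with ∈-map⁻ _ v∈
  ... | w , w∈ , refl with ∈-fibre⁻ f (class c) w∈
  ...   | w∈class-c , fw≡d = ∈-cartesianProduct⁺ w∈class-c (∈-class fw≡d)

  edges-unique : ∀ c d → Unique (edges c d)
  edges-unique c d = Unique.filter⁺ _ (Unique.filter⁺ _ (Unique.allFin⁺ n))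

  arcs-unique : ∀ c d → Unique (arcs c d)
  arcs-unique c d = Unique.cartesianProductWith⁺ arc arc-injective (Unique.allFin⁺ _) (edges-unique c d)

  arcsʳ-unique : ∀ c d → Unique (arcsʳ c d)
  arcsʳ-unique c d = Unique.cartesianProductWith⁺ arcʳ arcʳ-injective (Unique.allFin⁺ _) (edges-unique d c)

  loops-unique : ∀ c d → Unique (loops c d)
  loops-unique c d = Unique.map⁺ (cong proj₁) (Unique.filter⁺ _ (Unique.filter⁺ _ (Unique.allFin⁺ n)))

  arcs#arcsʳ : ∀ c d → Disjoint (arcs c d) (arcsʳ c d)
  arcs#arcsʳ c d (v∈arcs , v∈arcsʳ)
    with ∈-cartesianProductWith⁻ arc  (allFin _) (edges c d) v∈arcs
       | ∈-cartesianProductWith⁻ arcʳ (allFin _) (edges d c) v∈arcsʳ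
  ... | i , t , _ , _ , refl | j , s , _ , _ , e = arc≢arcʳ i j t s e

  arcs#loops : ∀ c d → Disjoint (arcs c d) (loops c d)
  arcs#loops c d (v∈arcs , v∈loops)
    with ∈-cartesianProductWith⁻ arc (allFin _) (edges c d) v∈arcs | ∈-map⁻ _ v∈loops
  ... | i , t , _ , _ , refl | _ , _ , e = arc-not-loop i t (trans (cong proj₁ e) (sym (cong proj₂ e)))

  arcsʳ#loops : ∀ c d → Disjoint (arcsʳ c d) (loops c d)
  arcsʳ#loops c d (v∈arcsʳ , v∈loops)
    with ∈-cartesianProductWith⁻ arcʳ (allFin _) (edges d c) v∈arcsʳ | ∈-map⁻ _ v∈loops
  ... | i , t , _ , _ , refl | _ , _ , e = arc-not-loop i t (trans (cong proj₂ e) (sym (cong proj₁ e)))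

  pairs-unique : ∀ c d → Unique (arcs c d ++ arcsʳ c d ++ loops c d)
  pairs-unique c d =
    Unique.++⁺ (arcs-unique c d) (Unique.++⁺ (arcsʳ-unique c d) (loops-unique c d) (arcsʳ#loops c d))
               (Disjoint-++ʳ (arcs#arcsʳ c d) (arcs#loops c d))

  pairs⊆classPairs : ∀ c d → arcs c d ++ arcsʳ c d ++ loops c d ⊆ classPairs c d
  pairs⊆classPairs c d = ++-⊆ (arcs⊆classPairs c d) (++-⊆ (arcsʳ⊆classPairs c d) (loops⊆classPairs c d))

  length-arcs : ∀ c d → length (arcs c d) ≡ suc k * count c d
  length-arcs c d = trans (length-cartesianProductWith arc (allFin _) (edges c d))
                          (cong (_* count c d) (length-allFin (suc k)))

  length-arcsʳ : ∀ c d → length (arcsʳ c d) ≡ suc k * count d c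
  length-arcsʳ c d = trans (length-cartesianProductWith arcʳ (allFin _) (edges d c))
                           (cong (_* count d c) (length-allFin (suc k)))

  arcs-bound : ∀ c d → suc k * count c d + (suc k * count d c + length (loops c d)) ≤ size c * size d
  arcs-bound c d = begin
    suc k * count c d + (suc k * count d c + length (loops c d))
      ≡⟨ cong₂ _+_ (length-arcs c d) (cong (_+ length (loops c d)) (length-arcsʳ c d)) ⟨
    length (arcs c d) + (length (arcsʳ c d) + length (loops c d))
      ≡⟨ trans (length-++ (arcs c d)) (cong (length (arcs c d) +_) (length-++ (arcsʳ c d))) ⟨
    length (arcs c d ++ arcsʳ c d ++ loops c d)
      ≤⟨ Unique-⊆⇒length-≤ (pairs-unique c d) (pairs⊆classPairs c d) ⟩
    length (classPairs c d)
      ≡⟨ length-cartesianProductWith _,_ (class c) (class d) ⟩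
    size c * size d ∎
    where open ≤-Reasoning

  length-loops-diagonal : ∀ c → length (loops c c) ≡ size c
  length-loops-diagonal c = begin
    length (loops c c)             ≡⟨ length-map _ (fibre f c (class c)) ⟩
    length (fibre f c (class c))   ≡⟨ cong length (filter-all P? (all-filter P? (allFin n))) ⟩
    size c                         ∎
    where
    open ≡-Reasoning
    P? = λ x → f x ≟ c

  count-diagonal-≤ : ∀ c → count c c ≤ floorDiv (size c * (size c ∸ 1)) (2 * suc k)
  count-diagonal-≤ c = ≤-floorDiv _ _ _ (begin
    2 * suc k * count c c       ≡⟨ +-*-Solver.solve 2 (λ K N → (con 2 :* K) :* N := K :* N :+ K :* N) refl (suc k) (count c c) ⟩
    a + a                       ≤⟨ m+n≤o⇒m≤o∸n (a + a) (begin
                                     a + a + s   ≡⟨ +-assoc a a s ⟩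
                                     a + (a + s) ≤⟨ subst (λ l → a + (a + l) ≤ s * s) (length-loops-diagonal c) (arcs-bound c c) ⟩
                                     s * s       ∎) ⟩
    s * s ∸ s                   ≡⟨ cong (s * s ∸_) (*-identityʳ s) ⟨
    s * s ∸ s * 1               ≡⟨ *-distribˡ-∸ s s 1 ⟨
    s * (s ∸ 1)                 ∎)
    where
    open ≤-Reasoning
    open +-*-Solver using (solve; _:*_; _:+_; _:=_; con)
    a = suc k * count c c
    s = size c

  count-pair-≤ : ∀ c d → count c d + count d c ≤ floorDiv (size c * size d) (suc k)
  count-pair-≤ c d = ≤-floorDiv _ _ k (begin
    suc k * (count c d + count d c)          ≡⟨ *-distribˡ-+ (suc k) (count c d) (count d c) ⟩
    suc k * count c d + suc k * count d c    ≤⟨ +-monoʳ-≤ (suc k * count c d) (m≤m+n _ _) ⟩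
    suc k * count c d + (suc k * count d c + length (loops c d)) ≤⟨ arcs-bound c d ⟩
    size c * size d                          ∎)
    where open ≤-Reasoning

  size-positive : ∀ c → 1 ≤ size c
  size-positive c with f-onto c
  ... | w , fw≡c = filter-some (λ x → f x ≟ c) (Any.map (λ { refl → fw≡c refl }) (∈-allFin w))

  sumFin-size : sumFin p size ≡ n
  sumFin-size = trans (sumFin-length-fibre f (allFin n)) (length-allFin n)

  sumFin²-count : sumFin p (λ c → sumFin p (count c)) ≡ n
  sumFin²-count = begin
    sumFin p (λ c → sumFin p (count c))
      ≡⟨ sumFin-cong p (λ c → sumFin-length-fibre (label ∘ next) (fibre label c (allFin n))) ⟩
    sumFin p (λ c → length (fibre label c (allFin n)))
      ≡⟨ sumFin-length-fibre label (allFin n) ⟩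
    length (allFin n)
      ≡⟨ length-allFin n ⟩
    n ∎
    where open ≡-Reasoning

  class-sizes-bound :
    Σ (Fin p → ℕ) λ m → (∀ i → 1 ≤ m i) × (sumFin p m ≡ n) ×
      (sumFin p (λ i → floorDiv (m i * (m i ∸ 1)) (2 * suc k))
        + sumPairs p (λ i j → floorDiv (m i * m j) (suc k)) ≥ n)
  class-sizes-bound = size , size-positive , sumFin-size , (begin
    n                                                            ≡⟨ sumFin²-count ⟨
    sumFin p (λ c → sumFin p (count c))                          ≡⟨ sumFin²≡diagonal+sumPairs p count ⟩
    sumFin p (λ c → count c c) + sumPairs p (λ c d → count c d + count d c)
      ≤⟨ +-mono-≤ (sumFin-mono-≤ p count-diagonal-≤) (sumPairs-mono-≤ p count-pair-≤) ⟩
    _                                                            ∎)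
    where open ≤-Reasoning

mainTheorem6 : (k x n p : ℕ) → 2 ≤ k → 1 ≤ x → x ≤ 2 * k ∸ 1 → n ≡ 2 * k + x →
               1 ≤ p → LeLambda p k n →
               Σ (Fin p → ℕ) λ m →
                 (∀ i → 1 ≤ m i) × (sumFin p m ≡ n) ×
                 (sumFin p (λ i → floorDiv (m i * (m i ∸ 1)) (2 * k))
                   + sumPairs p (λ i j → floorDiv (m i * m j) k) ≥ n)
mainTheorem6 (suc k) x n p 2≤k _ _ n≡2k+x 1≤p p≤λ =
  ClassCounting.class-sizes-bound 3≤n (LeLambda⇒LabeledPacking 1≤p p≤λ)
  where
  3≤n : 3 ≤ n
  3≤n = begin
    3             ≤⟨ n≤1+n 3 ⟩
    2 * 2         ≤⟨ *-monoʳ-≤ 2 2≤k ⟩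
    2 * suc k     ≤⟨ m≤m+n (2 * suc k) x ⟩
    2 * suc k + x ≡⟨ n≡2k+x ⟨
    n             ∎
    where open ≤-Reasoning
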